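{- Let $l$ be an integer with $0\le l\le m$. If $(n;H_1,\dots,H_m)\in\mathcal{C}_{X_m,l,1}$, then there is a non-negative integer $\alpha_0\ge\max_{1\le i\le m}d_{0,i}$ such that $\sum_{i=1}^m d_{0,i}-(m-l)\alpha_0\ge0$.
   Context: Fix a prime $p$; $\mathbb{Z}_p$ is the $p$-adic integers; $\overline{\mathbb{Z}}_{\ge1}=\mathbb{Z}_{\ge1}\cup\{\infty\}$, $p^\infty=0$. $X_m=\{x_1,\dots,x_m\}$ is an ordered subset of $\mathbb{Z}_p$ of size $m$ with pairwise distinct reductions mod $p$. $\mathcal{M}_{\mathbb{Z}_p}$: isomorphism classes of finitely generated $\mathbb{Z}_p$-modules; $s(H)=\dim_{\mathbb{F}_p}(H/pH)$. $\mathcal{B}_m:=\{(n;H_1,\dots,H_m)\in\mathbb{Z}_{\ge0}\times\mathcal{M}_{\mathbb{Z}_p}^m: n\ge s(H_i)\ \forall i\}$; write $H_i\cong\prod_{r\in\overline{\mathbb{Z}}_{\ge1}}(\mathbb{Z}_p/p^r\mathbb{Z}_p)^{d_{r,i}}$ and $d_{0,i}:=n-\sum_{r\in\overline{\mathbb{Z}}_{\ge1}}d_{r,i}$. An $l$-th integral is a polynomial in $\operatorname{M}_n(\mathbb{Z}_p)[t]$ of the form $A_0+tA_1+\dots+t^lA_l+pt^{l+1}A_{l+1}+\dots+p^rt^{l+r}A_{l+r}$. $\mathcal{C}_{X_m,l,1}$ is the set of $(n;H_1,\dots,H_m)\in\mathcal{B}_m$ such that some $l$-th integral $P(t)\in\operatorname{M}_n(\mathbb{Z}_p)[t]$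 satisfies $\operatorname{cok}_{\mathbb{F}_p}(\overline{P(x_i)})\cong H_i/pH_i$ for all $i$, where $\overline{\,\cdot\,}$ is reduction mod $p$. -}

module Defs where

open import Data.Nat using (ℕ; zero; suc; _+_; _*_; _∸_; _^_; _≤_; _<_; _%_; NonZero)
open import Data.Nat.Properties using (m^n≢0)
open import Data.Nat.Divisibility using (_∣_)
open import Data.Fin using (Fin; toℕ)
open import Data.List using (List; length)
open import Data.Product using (Σ; _×_)
open import Relation.Binary.PropositionalEquality using (_≡_)
open import Relation.Nullary using (¬_)

sumFin : ∀ {k} → (Fin k → ℕ) → ℕ
sumFin {zero}  f = 0
sumFin {suc k} f = f Fin.zero + sumFin (λ j → f (Fin.suc j))

module _ (p : ℕ) .{{nz : NonZero p}} where

  modP^ : ℕ → ℕ → ℕ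
  modP^ k x = _%_ x (p ^ k) {{m^n≢0 p k}}

  -- p-adic integers  ℤ_p = lim ℤ/p^k, as compatible residue sequences:
  -- seq k ∈ {0,…,p^k-1} is the residue modulo p^k.
  record ℤp : Set where
    field
      seq    : ℕ → ℕ
      bound  : ∀ k → seq k < p ^ k
      compat : ∀ k → modP^ k (seq (suc k)) ≡ seq k
  open ℤp public

  -- Level-wise arithmetic (on residue sequences); for genuine p-adic
  -- inputs, level k of the result is the residue mod p^k of the true
  -- p-adic sum/product.
  Seq : Set
  Seq = ℕ → ℕ

  _⊕_ : Seq → Seq → Seq
  (a ⊕ b) k = modP^ k (a k + b k)

  _⊗_ : Seq → Seq → Seq
  (a ⊗ b) k = modP^ k (a k * b k)

  const : ℕ → Seq
  const c k = modP^ k c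

  _^ₛ_ : Seq → ℕ → Seq
  a ^ₛ zero  = const 1
  a ^ₛ suc j = a ⊗ (a ^ₛ j)

  sumSeq : ∀ {k} → (Fin k → Seq) → Seq
  sumSeq {zero}  f = const 0
  sumSeq {suc k} f = f Fin.zero ⊕ sumSeq (λ j → f (Fin.suc j))

  red : Seq → ℕ
  red a = a 1

  Matℤp : ℕ → Set
  Matℤp n = Fin n → Fin n → ℤp

  -- An l-th integral in M_n(ℤ_p)[t] is given by r : ℕ and coefficients
  -- A_0,…,A_{l+r}; it is  P(t) = Σ_{j ≤ l+r} p^{j ∸ l} t^j A_j, i.e.
  -- A_0 + t A_1 + … + t^l A_l + p t^{l+1} A_{l+1} + … + p^r t^{l+r} A_{l+r}.
  record LthIntegral (n l : ℕ) : Set where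
    field
      r    : ℕ
      coef : Fin (suc (l + r)) → Matℤp n
  open LthIntegral public

  evalInt : ∀ {n l} → LthIntegral n l → ℤp → Fin n → Fin n → Seq
  evalInt {n} {l} P x a b =
    sumSeq (λ j → ((seq x ^ₛ toℕ j) ⊗ const (p ^ (toℕ j ∸ l)))
                    ⊗ seq (coef P j a b))

  redEval : ∀ {n l} → LthIntegral n l → ℤp → Fin n → Fin n → ℕ
  redEval P x a b = red (evalInt P x a b)

  LinIndep : ∀ {n k} → (Fin k → Fin n → ℕ) → Set
  LinIndep {n} {k} v =
    (c : Fin k → ℕ) → (∀ a → p ∣ sumFin (λ j → c j * v j a)) → ∀ j → p ∣ c j

  HasRank : ∀ {n} → (Fin n → Fin n → ℕ) → ℕ → Set
  HasRank {n} M ρ =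
    Σ (Fin ρ → Fin n) (λ σ → LinIndep (λ j a → M a (σ j)))
    × ((σ : Fin (suc ρ) → Fin n) → ¬ LinIndep (λ j a → M a (σ j)))

  -- dim_{𝔽_p} cok(M) = s  (cok(M) = 𝔽_p^n / im M ≅ 𝔽_p^s)
  CokDim : ∀ {n} → (Fin n → Fin n → ℕ) → ℕ → Set
  CokDim {n} M s = s ≤ n × HasRank M (n ∸ s)

-- Finitely generated ℤ_p-modules up to isomorphism:
-- H ≅ ∏_{e} ℤ_p/p^e ℤ_p  with e ∈ ℤ̄_{≥1} = ℤ_{≥1} ∪ {∞}.
data ℤ̄≥1 : Set where
  fin : ℕ → ℤ̄≥1     -- fin k stands for the exponent k+1
  ∞   : ℤ̄≥1         -- p^∞ = 0, factor ℤ_p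

-- a module is recorded by the list of exponents of its cyclic factors
-- (structure theorem; only its multiset matters)
FGModule : Set
FGModule = List ℤ̄≥1

-- s(H) = dim_{𝔽_p} H/pH = number of cyclic factors = Σ_r d_r
s : FGModule → ℕ
s = length

d₀ : ℕ → FGModule → ℕ
d₀ n H = n ∸ s H

InB : ∀ {m} → ℕ → (Fin m → FGModule) → Set
InB n H = ∀ i → s (H i) ≤ n

module _ (p : ℕ) .{{nz : NonZero p}} where
  DistinctRed : ∀ {m} → (Fin m → ℤp p) → Set
  DistinctRed {m} x = ∀ i j → red p (seq (x i)) ≡ red p (seq (x j)) → i ≡ j

  InC : ∀ {m} → (Fin m → ℤp p) → ℕ → ℕ → (Fin m → FGModule) → Set
  InC {m} x l n H =
    InB n H × Σ (LthIntegral p n l)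
                (λ P → ∀ i → CokDim p (redEval p P (x i)) (s (H i)))

module Submission where

-- Reduce modulo p. The coefficients of an l-th integral P beyond degree l carry a factor p, so
-- its reduction P̄ is a matrix polynomial of degree at most l over 𝔽_p, and d_{0,i} = n − s(H_i)
-- is the rank of P̄(x_i). Take α₀ = d_{0,k} maximal and independent columns P̄(x_k) e_q, q < α₀.
-- In ⊕_i 𝔽_pⁿ the (m − l) α₀ vectors ((x_i − x_k)^a P̄(x_i) e_q)_i, a < m − l, are independent:
-- a vanishing combination Σ c_{a,q} (t − x_k)^a P̄(t) e_q has degree < m and the m roots x_i, so
-- it is zero, and then its coefficients in powers of t − x_k vanish one after the other because
-- the P̄(x_k) e_q are independent. Up to nonzero scalars these vectors lie in ⊕_i im P̄(x_i),
-- which is spanned by Σ_i d_{0,i} vectors, so (m − l) α₀ ≤ Σ_i d_{0,i}.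

open import Algebra.Bundles using (CommutativeRing)
open import Algebra.Structures using (IsCommutativeRing)
open import Data.Empty using (⊥-elim)
open import Data.Fin as Fin using (Fin; zero; suc; toℕ; _↑ˡ_; _↑ʳ_; combine; remQuot; punchIn; punchOut)
import Data.Fin.Properties as Finₚ
open import Data.Fin.Properties using (all?; ¬∀⟶∃¬)
open import Data.Maybe using (nothing)
open import Data.Nat as ℕ using (ℕ; zero; suc; _∸_; _%_; _≤_; _<_; z≤n; s≤s; NonZero)
open import Data.Nat.Base using (nonTrivial⇒n>1)
open import Data.Nat.DivMod using (%-distribˡ-+; %-distribˡ-*; m<n⇒m%n≡m; m*n%n≡0; %-congʳ; m%n%n≡m%n)
open import Data.Nat.Divisibility using (_∣_; m%n≡0⇒n∣m; n∣m⇒m%n≡0; ∣⇒≤; ∣-trans; m∣m*n)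
open import Data.Nat.Primality using (Prime; euclidsLemma; prime⇒nonTrivial)
import Data.Nat.Properties as ℕₚ
open import Data.Product using (Σ; ∃; ∃₂; _×_; _,_; proj₁; proj₂; uncurry)
open import Data.Sum as Sum using (_⊎_; inj₁; inj₂; [_,_]′)
open import Data.Vec.Functional using (removeAt; _∷_)
open import Function using (_∘_; case_of_)
open import Level using (_⊔_; 0ℓ)
open import Relation.Binary.PropositionalEquality as ≡ using (_≡_; _≢_)
open import Relation.Nullary using (Dec; yes; no; ¬_)
open import Relation.Nullary.Decidable using (decidable-stable)
open import Relation.Nullary.Negation.Core using (¬¬-map)
open import Tactic.RingSolver.Core.AlmostCommutativeRing using (AlmostCommutativeRing; fromCommutativeRing)
open import Defs
  using (sumFin; ℤp; seq; bound; LthIntegral; coef; r; Seq; modP^; sumSeq; _^ₛ_; const; redEval;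
         LinIndep; HasRank; CokDim; DistinctRed; InC; FGModule; s; d₀)
  renaming (_⊗_ to _⊗ₛ_)

module Polynomials {c ℓ} (R : CommutativeRing c ℓ) where

  open CommutativeRing R hiding (zero)
  open import Algebra.Properties.Ring ring using (-1*x≈-x)
  open import Algebra.Properties.Semiring.Exp semiring using (_^_)
  open import Algebra.Properties.Semiring.Sum semiring
    using (sum; sum-cong-≋; sum-replicate-zero; ∑-distrib-+; *-distribˡ-sum)
  open import Relation.Binary.Reasoning.Setoid setoid

  private
    almostCommutativeRing : AlmostCommutativeRing c ℓ
    almostCommutativeRing = fromCommutativeRing R (λ _ → nothing)

  open import Tactic.RingSolver.NonReflective almostCommutativeRing using (solve; _⊜_; _⊕_; _⊗_)

  sum-zero : ∀ {k} {f : Fin k → Carrier} → (∀ j → f j ≈ 0#) → sum f ≈ 0#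
  sum-zero {k} f≈0 = trans (sum-cong-≋ f≈0) (sum-replicate-zero k)

  sum-neg : ∀ {k} (f : Fin k → Carrier) → sum (λ j → - f j) ≈ - sum f
  sum-neg f = begin
    sum (λ j → - f j)       ≈⟨ sum-cong-≋ (λ j → sym (-1*x≈-x (f j))) ⟩
    sum (λ j → - 1# * f j)  ≈⟨ sym (*-distribˡ-sum (- 1#) f) ⟩
    - 1# * sum f            ≈⟨ -1*x≈-x (sum f) ⟩
    - sum f                 ∎

  sum-splitAt : ∀ a b (f : Fin (a ℕ.+ b) → Carrier) →
                sum f ≈ sum (λ i → f (i ↑ˡ b)) + sum (λ j → f (a ↑ʳ j))
  sum-splitAt zero    b f = sym (+-identityˡ _)
  sum-splitAt (suc a) b f = trans (+-congˡ (sum-splitAt a b (f ∘ suc))) (sym (+-assoc _ _ _))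

  sum-combine : ∀ a b (f : Fin (a ℕ.* b) → Carrier) →
                sum f ≈ sum (λ i → sum (λ j → f (combine {a} {b} i j)))
  sum-combine zero    b f = refl
  sum-combine (suc a) b f = trans (sum-splitAt b (a ℕ.* b) f) (+-congˡ (sum-combine a b _))

  Independent : ∀ {I : Set} {K} → (Fin K → I → Carrier) → Set (c ⊔ ℓ)
  Independent {K = K} v =
    ∀ (cc : Fin K → Carrier) → (∀ x → sum (λ j → cc j * v j x) ≈ 0#) → ∀ j → cc j ≈ 0#

  Independent-cong : ∀ {I : Set} {K} {v w : Fin K → I → Carrier} →
                     (∀ j x → v j x ≈ w j x) → Independent v → Independent w
  Independent-cong {K = K} v≈w v-independent cc relation =
    v-independent cc (λ x → trans (sum-cong-≋ {K} (λ j → *-congˡ (v≈w j x))) (relation x))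

  Poly : Set c
  Poly = ℕ → Carrier

  DegreeBelow : ℕ → Poly → Set ℓ
  DegreeBelow L f = ∀ j → L ≤ j → f j ≈ 0#

  -- eval L f y = Σ_{j < L} f j * y ^ j by Horner's rule; the coefficients from L on are ignored.
  eval : ℕ → Poly → Carrier → Carrier
  eval zero    f y = 0#
  eval (suc L) f y = f 0 + y * eval L (f ∘ suc) y

  X*_ : Poly → Poly
  (X* g) zero    = 0#
  (X* g) (suc j) = g j

  constant : Carrier → Poly
  constant x zero    = x
  constant x (suc j) = 0#

  mulLinear : Carrier → Poly → Poly
  mulLinear a g j = (X* g) j + (- a) * g j

  eval-cong : ∀ L {f g : Poly} y → (∀ j → f j ≈ g j) → eval L f y ≈ eval L g y
  eval-cong zero    y f≈g = refl
  eval-cong (suc L) y f≈g = +-cong (f≈g 0) (*-congˡ (eval-cong L y (f≈g ∘ suc)))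

  eval-zero : ∀ L {f : Poly} y → (∀ j → f j ≈ 0#) → eval L f y ≈ 0#
  eval-zero zero    y f≈0 = refl
  eval-zero (suc L) y f≈0 =
    trans (+-cong (f≈0 0) (trans (*-congˡ (eval-zero L y (f≈0 ∘ suc))) (zeroʳ y))) (+-identityʳ 0#)

  eval-+ : ∀ L (f g : Poly) y → eval L (λ j → f j + g j) y ≈ eval L f y + eval L g y
  eval-+ zero    f g y = sym (+-identityʳ 0#)
  eval-+ (suc L) f g y = begin
    (f 0 + g 0) + y * eval L (λ j → f (suc j) + g (suc j)) y
      ≈⟨ +-congˡ (*-congˡ (eval-+ L (f ∘ suc) (g ∘ suc) y)) ⟩
    (f 0 + g 0) + y * (eval L (f ∘ suc) y + eval L (g ∘ suc) y)
      ≈⟨ solve 5 (λ a b y u v → ((a ⊕ b) ⊕ y ⊗ (u ⊕ v)) ⊜ ((a ⊕ y ⊗ u) ⊕ (b ⊕ y ⊗ v))) refl _ _ _ _ _ ⟩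
    (f 0 + y * eval L (f ∘ suc) y) + (g 0 + y * eval L (g ∘ suc) y) ∎

  eval-*ˡ : ∀ L a (f : Poly) y → eval L (λ j → a * f j) y ≈ a * eval L f y
  eval-*ˡ zero    a f y = sym (zeroʳ a)
  eval-*ˡ (suc L) a f y = begin
    a * f 0 + y * eval L (λ j → a * f (suc j)) y
      ≈⟨ +-congˡ (*-congˡ (eval-*ˡ L a (f ∘ suc) y)) ⟩
    a * f 0 + y * (a * eval L (f ∘ suc) y)
      ≈⟨ solve 4 (λ a f y e → (a ⊗ f ⊕ y ⊗ (a ⊗ e)) ⊜ (a ⊗ (f ⊕ y ⊗ e))) refl _ _ _ _ ⟩
    a * (f 0 + y * eval L (f ∘ suc) y) ∎

  eval-sum : ∀ L {k} (F : Fin k → Poly) y →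
             eval L (λ j → sum (λ q → F q j)) y ≈ sum (λ q → eval L (F q) y)
  eval-sum L {zero}  F y = eval-zero L y (λ j → refl)
  eval-sum L {suc k} F y =
    trans (eval-+ L (F zero) (λ j → sum (λ q → F (suc q) j)) y) (+-congˡ (eval-sum L (F ∘ suc) y))

  eval-extend : ∀ L B (f : Poly) y → DegreeBelow L f → L ≤ B → eval B f y ≈ eval L f y
  eval-extend zero    B       f y f<L _         = eval-zero B y (λ j → f<L j z≤n)
  eval-extend (suc L) (suc B) f y f<L (s≤s L≤B) =
    +-congˡ (*-congˡ (eval-extend L B (f ∘ suc) y (λ j → f<L (suc j) ∘ s≤s) L≤B))

  eval-mulLinear : ∀ L a g y → DegreeBelow L g → eval (suc L) (mulLinear a g) y ≈ (y - a) * eval L g y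
  eval-mulLinear L a g y g<L = begin
    eval (suc L) (mulLinear a g) y
      ≈⟨ eval-+ (suc L) (X* g) (λ j → (- a) * g j) y ⟩
    (0# + y * eval L g y) + eval (suc L) (λ j → (- a) * g j) y
      ≈⟨ +-cong (+-identityˡ _) (eval-*ˡ (suc L) (- a) g y) ⟩
    y * eval L g y + (- a) * eval (suc L) g y
      ≈⟨ +-congˡ (*-congˡ (eval-extend L (suc L) g y g<L (ℕₚ.n≤1+n L))) ⟩
    y * eval L g y + (- a) * eval L g y
      ≈⟨ sym (distribʳ _ _ _) ⟩
    (y - a) * eval L g y ∎

  DegreeBelow-mono : ∀ {L L′ f} → DegreeBelow L f → L ≤ L′ → DegreeBelow L′ f
  DegreeBelow-mono f<L L≤L′ j L′≤j = f<L j (ℕₚ.≤-trans L≤L′ L′≤j)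

  DegreeBelow-+ : ∀ {L f g} → DegreeBelow L f → DegreeBelow L g → DegreeBelow L (λ j → f j + g j)
  DegreeBelow-+ f<L g<L j L≤j = trans (+-cong (f<L j L≤j) (g<L j L≤j)) (+-identityʳ 0#)

  DegreeBelow-*ˡ : ∀ {L} a {f} → DegreeBelow L f → DegreeBelow L (λ j → a * f j)
  DegreeBelow-*ˡ a f<L j L≤j = trans (*-congˡ (f<L j L≤j)) (zeroʳ a)

  DegreeBelow-sum : ∀ {L k} (F : Fin k → Poly) → (∀ q → DegreeBelow L (F q)) →
                    DegreeBelow L (λ j → sum (λ q → F q j))
  DegreeBelow-sum F F<L j L≤j = sum-zero (λ q → F<L q j L≤j)

  DegreeBelow-mulLinear : ∀ {L} a {g} → DegreeBelow L g → DegreeBelow (suc L) (mulLinear a g)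
  DegreeBelow-mulLinear a {g} g<L =
    DegreeBelow-+ X*g<1+L (DegreeBelow-*ˡ (- a) (DegreeBelow-mono g<L (ℕₚ.n≤1+n _)))
    where
    X*g<1+L : DegreeBelow _ (X* g)
    X*g<1+L (suc j) (s≤s L≤j) = g<L j L≤j

  -- Synthetic division by X - a of a polynomial with L coefficients.
  quotient : ℕ → Carrier → Poly → Poly
  quotient zero    a f j       = 0#
  quotient (suc L) a f zero    = eval L (f ∘ suc) a
  quotient (suc L) a f (suc j) = quotient L a (f ∘ suc) j

  DegreeBelow-quotient : ∀ L a f → DegreeBelow L (quotient (suc L) a f)
  DegreeBelow-quotient zero    a f zero    _         = refl
  DegreeBelow-quotient zero    a f (suc j) _         = refl
  DegreeBelow-quotient (suc L) a f (suc j) (s≤s L≤j) = DegreeBelow-quotient L a (f ∘ suc) j L≤j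

  division : ∀ L a (f : Poly) → DegreeBelow L f →
             ∀ j → f j ≈ constant (eval L f a) j + mulLinear a (quotient L a f) j
  division zero a f f<0 j = trans (f<0 j z≤n) (sym (remainder≈0 j))
    where
    remainder≈0 : ∀ j → constant 0# j + mulLinear a (quotient zero a f) j ≈ 0#
    remainder≈0 zero    = trans (+-identityˡ _) (trans (+-identityˡ _) (zeroʳ (- a)))
    remainder≈0 (suc j) = trans (+-identityˡ _) (trans (+-identityˡ _) (zeroʳ (- a)))
  division (suc L) a f f<L zero = begin
    f 0                               ≈⟨ sym (+-identityʳ _) ⟩
    f 0 + 0#                          ≈⟨ +-congˡ (sym aE-aE≈0) ⟩
    f 0 + (a * E + (- a) * E)         ≈⟨ sym (+-assoc _ _ _) ⟩
    (f 0 + a * E) + (- a) * E         ≈⟨ +-congˡ (sym (+-identityˡ _)) ⟩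
    (f 0 + a * E) + (0# + (- a) * E)  ∎
    where
    E = eval L (f ∘ suc) a
    aE-aE≈0 : a * E + (- a) * E ≈ 0#
    aE-aE≈0 = trans (sym (distribʳ E a (- a))) (trans (*-congʳ (-‿inverseʳ a)) (zeroˡ E))
  division (suc L) a f f<L (suc j) = begin
    f (suc j)
      ≈⟨ division L a (f ∘ suc) (λ i → f<L (suc i) ∘ s≤s) j ⟩
    constant E j + ((X* g) j + (- a) * g j)
      ≈⟨ sym (+-assoc _ _ _) ⟩
    (constant E j + (X* g) j) + (- a) * g j
      ≈⟨ +-congʳ (shift j) ⟩
    quotient (suc L) a f j + (- a) * g j
      ≈⟨ sym (+-identityˡ _) ⟩
    0# + (quotient (suc L) a f j + (- a) * g j) ∎
    where
    E = eval L (f ∘ suc) a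
    g = quotient L a (f ∘ suc)
    shift : ∀ j → constant E j + (X* g) j ≈ quotient (suc L) a f j
    shift zero    = +-identityʳ E
    shift (suc j) = +-identityˡ _

  eval-division : ∀ L a (f : Poly) y → DegreeBelow (suc L) f →
                  eval (suc L) f y ≈ eval (suc L) f a + (y - a) * eval L (quotient (suc L) a f) y
  eval-division L a f y f<1+L = begin
    eval (suc L) f y
      ≈⟨ eval-cong (suc L) y (division (suc L) a f f<1+L) ⟩
    eval (suc L) (λ j → constant E j + mulLinear a g j) y
      ≈⟨ eval-+ (suc L) (constant E) (mulLinear a g) y ⟩
    eval (suc L) (constant E) y + eval (suc L) (mulLinear a g) y
      ≈⟨ +-cong eval-constant (eval-mulLinear L a g y (DegreeBelow-quotient L a f)) ⟩
    E + (y - a) * eval L g y ∎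
    where
    E = eval (suc L) f a
    g = quotient (suc L) a f
    eval-constant : eval (suc L) (constant E) y ≈ E
    eval-constant =
      trans (+-congˡ (trans (*-congˡ (eval-zero L y (λ j → refl))) (zeroʳ y))) (+-identityʳ E)

  mulLinear-injective : ∀ L a (g : Poly) → DegreeBelow L g →
                        (∀ j → mulLinear a g j ≈ 0#) → ∀ j → g j ≈ 0#
  mulLinear-injective L a g g<L ag≈0 j = descend L j (ℕₚ.m≤n+m L j)
    where
    -- g vanishes from L on, and g j ≈ a * g (j + 1) carries this downwards.
    descend : ∀ d j → L ≤ j ℕ.+ d → g j ≈ 0#
    descend zero    j L≤j   = g<L j (≡.subst (L ≤_) (ℕₚ.+-identityʳ j) L≤j)
    descend (suc d) j L≤j+d = begin
      g j                      ≈⟨ sym (+-identityʳ _) ⟩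
      g j + 0#                 ≈⟨ +-congˡ (sym (trans (*-congˡ g[1+j]≈0) (zeroʳ _))) ⟩
      g j + (- a) * g (suc j)  ≈⟨ ag≈0 (suc j) ⟩
      0#                       ∎
      where g[1+j]≈0 = descend d (suc j) (≡.subst (L ≤_) (ℕₚ.+-suc j d) L≤j+d)

  fromVector : ∀ {N} → (Fin N → Carrier) → Poly
  fromVector {zero}  f j       = 0#
  fromVector {suc N} f zero    = f zero
  fromVector {suc N} f (suc j) = fromVector (f ∘ suc) j

  fromVector-toℕ : ∀ {N} (f : Fin N → Carrier) a → fromVector f (toℕ a) ≡ f a
  fromVector-toℕ f zero    = ≡.refl
  fromVector-toℕ f (suc a) = fromVector-toℕ (f ∘ suc) a

  eval-fromVector : ∀ N (f : Fin N → Carrier) y → eval N (fromVector f) y ≈ sum (λ a → f a * y ^ toℕ a)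
  eval-fromVector zero    f y = refl
  eval-fromVector (suc N) f y = begin
    f zero + y * eval N (fromVector (f ∘ suc)) y
      ≈⟨ +-cong (sym (*-identityʳ _)) (*-congˡ (eval-fromVector N (f ∘ suc) y)) ⟩
    f zero * 1# + y * sum (λ a → f (suc a) * y ^ toℕ a)
      ≈⟨ +-congˡ (trans (*-distribˡ-sum y (λ a → f (suc a) * y ^ toℕ a)) (sum-cong-≋ {N} (λ a →
           solve 3 (λ y u v → (y ⊗ (u ⊗ v)) ⊜ (u ⊗ (y ⊗ v))) refl y (f (suc a)) (y ^ toℕ a)))) ⟩
    f zero * 1# + sum (λ a → f (suc a) * (y * y ^ toℕ a)) ∎

  DegreeBelow-fromVector : ∀ N (f : Fin N → Carrier) L → (∀ a → L ≤ toℕ a → f a ≈ 0#) →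
                           DegreeBelow L (fromVector f)
  DegreeBelow-fromVector zero    f L f≈0 j       L≤j = refl
  DegreeBelow-fromVector (suc N) f L f≈0 zero    L≤0 = f≈0 zero L≤0
  DegreeBelow-fromVector (suc N) f L f≈0 (suc j) L≤j =
    DegreeBelow-fromVector N (f ∘ suc) (L ∸ 1)
      (λ a L∸1≤a → f≈0 (suc a) (ℕₚ.≤-trans (ℕₚ.m≤n+m∸n L 1) (s≤s L∸1≤a))) j (ℕₚ.∸-monoˡ-≤ 1 L≤j)

  -- combination N u b = Σ_q (Σ_{i < N} u q i (X - a)^i) * Q q b, by Horner's rule in X - a.
  module Combination {ρ l} {B : Set} (Q : Fin ρ → B → Poly) (Q<1+l : ∀ q b → DegreeBelow (suc l) (Q q b))
                     (a : Carrier) where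

    combination : ℕ → (Fin ρ → Poly) → B → Poly
    combination zero    u b j = 0#
    combination (suc N) u b j =
      sum (λ q → u q 0 * Q q b j) + mulLinear a (combination N (λ q → u q ∘ suc) b) j

    DegreeBelow-combination : ∀ N u b → DegreeBelow (N ℕ.+ l) (combination N u b)
    DegreeBelow-combination zero    u b j _ = refl
    DegreeBelow-combination (suc N) u b = DegreeBelow-+
      (DegreeBelow-mono (DegreeBelow-sum _ (λ q → DegreeBelow-*ˡ (u q 0) (Q<1+l q b))) (s≤s (ℕₚ.m≤n+m l N)))
      (DegreeBelow-mulLinear a (DegreeBelow-combination N (λ q → u q ∘ suc) b))

    eval-combination : ∀ N u b y →
      eval (N ℕ.+ l) (combination N u b) y ≈ sum (λ q → eval (suc l) (Q q b) y * eval N (u q) (y - a))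
    eval-combination zero    u b y =
      trans (eval-zero l y (λ j → refl)) (sym (sum-zero (λ q → zeroʳ (eval (suc l) (Q q b) y))))
    eval-combination (suc N) u b y = begin
      eval (suc (N ℕ.+ l)) (λ j → sum (λ q → u q 0 * Q q b j) + mulLinear a W j) y
        ≈⟨ eval-+ (suc (N ℕ.+ l)) (λ j → sum (λ q → u q 0 * Q q b j)) (mulLinear a W) y ⟩
      eval (suc (N ℕ.+ l)) (λ j → sum (λ q → u q 0 * Q q b j)) y + eval (suc (N ℕ.+ l)) (mulLinear a W) y
        ≈⟨ +-cong (trans (eval-sum (suc (N ℕ.+ l)) (λ q j → u q 0 * Q q b j) y) (sum-cong-≋ {ρ} eval-head))
                  (eval-mulLinear (N ℕ.+ l) a W y (DegreeBelow-combination N (λ q → u q ∘ suc) b)) ⟩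
      sum (λ q → u q 0 * Qy q) + (y - a) * eval (N ℕ.+ l) W y
        ≈⟨ +-congˡ (*-congˡ (eval-combination N (λ q → u q ∘ suc) b y)) ⟩
      sum (λ q → u q 0 * Qy q) + (y - a) * sum (λ q → Qy q * U q)
        ≈⟨ +-congˡ (*-distribˡ-sum (y - a) (λ q → Qy q * U q)) ⟩
      sum (λ q → u q 0 * Qy q) + sum (λ q → (y - a) * (Qy q * U q))
        ≈⟨ sym (∑-distrib-+ (λ q → u q 0 * Qy q) (λ q → (y - a) * (Qy q * U q))) ⟩
      sum (λ q → u q 0 * Qy q + (y - a) * (Qy q * U q))
        ≈⟨ sum-cong-≋ {ρ} (λ q → solve 4 (λ u v d e → (u ⊗ v ⊕ d ⊗ (v ⊗ e)) ⊜ (v ⊗ (u ⊕ d ⊗ e)))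
                                         refl (u q 0) (Qy q) (y - a) (U q)) ⟩
      sum (λ q → Qy q * (u q 0 + (y - a) * U q)) ∎
      where
      W  = combination N (λ q → u q ∘ suc) b
      Qy = λ q → eval (suc l) (Q q b) y
      U  = λ q → eval N (u q ∘ suc) (y - a)
      eval-head : ∀ q → eval (suc (N ℕ.+ l)) (λ j → u q 0 * Q q b j) y ≈ u q 0 * Qy q
      eval-head q = trans (eval-*ˡ (suc (N ℕ.+ l)) (u q 0) (Q q b) y) (*-congˡ
        (eval-extend (suc l) (suc (N ℕ.+ l)) (Q q b) y (Q<1+l q b) (s≤s (ℕₚ.m≤n+m l N))))

    module _ (Q[a]-independent : Independent (λ q b → eval (suc l) (Q q b) a)) where

      head-zero : ∀ N u → (∀ b j → combination (suc N) u b j ≈ 0#) → ∀ q → u q 0 ≈ 0#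
      head-zero N u W≈0 = Q[a]-independent (λ q → u q 0) λ b → begin
        sum (λ q → u q 0 * eval (suc l) (Q q b) a)
          ≈⟨ sum-cong-≋ {ρ} (λ q → trans (*-comm _ _) (*-congˡ (sym (eval-at-centre q)))) ⟩
        sum (λ q → eval (suc l) (Q q b) a * eval (suc N) (u q) (a - a))
          ≈⟨ sym (eval-combination (suc N) u b a) ⟩
        eval (suc N ℕ.+ l) (combination (suc N) u b) a
          ≈⟨ eval-zero (suc N ℕ.+ l) a (W≈0 b) ⟩
        0# ∎
        where
        eval-at-centre : ∀ q → eval (suc N) (u q) (a - a) ≈ u q 0
        eval-at-centre q = trans (+-congˡ (trans (*-congʳ (-‿inverseʳ a)) (zeroˡ _))) (+-identityʳ _)

      tail-zero : ∀ N u → (∀ b j → combination (suc N) u b j ≈ 0#) →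
                  ∀ b j → combination N (λ q → u q ∘ suc) b j ≈ 0#
      tail-zero N u W≈0 b =
        mulLinear-injective (N ℕ.+ l) a W (DegreeBelow-combination N (λ q → u q ∘ suc) b) λ j → begin
          mulLinear a W j                                ≈⟨ sym (+-identityˡ _) ⟩
          0# + mulLinear a W j                           ≈⟨ +-congʳ (sym (sum-zero (head≈0 j))) ⟩
          sum (λ q → u q 0 * Q q b j) + mulLinear a W j  ≈⟨ W≈0 b j ⟩
          0#                                             ∎
        where
        W = combination N (λ q → u q ∘ suc) b
        head≈0 : ∀ j q → u q 0 * Q q b j ≈ 0#
        head≈0 j q = trans (*-congʳ (head-zero N u W≈0 q)) (zeroˡ _)

      combination-zero : ∀ N u → (∀ b j → combination N u b j ≈ 0#) → ∀ q i → i < N → u q i ≈ 0#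
      combination-zero (suc N) u W≈0 q zero    _         = head-zero N u W≈0 q
      combination-zero (suc N) u W≈0 q (suc i) (s≤s i<N) =
        combination-zero N (λ q → u q ∘ suc) (tail-zero N u W≈0) q i i<N

embed : ∀ {m} (r : Fin m → ℕ) (i : Fin m) → Fin (r i) → Fin (sumFin r)
embed r zero    s = s ↑ˡ sumFin (r ∘ suc)
embed r (suc i) s = r zero ↑ʳ embed (r ∘ suc) i s

block : ∀ {a m} {A : Set a} (r : Fin m → ℕ) → ((i : Fin m) → Fin (r i) → A) → Fin (sumFin r) → A
block {m = zero}  r F ()
block {m = suc m} r F t = [ F zero , block (r ∘ suc) (F ∘ suc) ]′ (Fin.splitAt (r zero) t)

block-embed : ∀ {a m} {A : Set a} (r : Fin m → ℕ) (F : (i : Fin m) → Fin (r i) → A) i s →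
              block r F (embed r i s) ≡ F i s
block-embed r F zero    s rewrite Finₚ.splitAt-↑ˡ (r zero) s (sumFin (r ∘ suc)) = ≡.refl
block-embed r F (suc i) s rewrite Finₚ.splitAt-↑ʳ (r zero) (sumFin (r ∘ suc)) (embed (r ∘ suc) i s) =
  block-embed (r ∘ suc) (F ∘ suc) i s

record IsDecidableDomain {c ℓ} (R : CommutativeRing c ℓ) : Set (c ⊔ ℓ) where
  open CommutativeRing R
  field
    _≟0          : ∀ x → Dec (x ≈ 0#)
    zero-product : ∀ {x y} → x * y ≈ 0# → x ≈ 0# ⊎ y ≈ 0#
    1≉0          : 1# ≉ 0#

module IntegralDomain {c ℓ} (R : CommutativeRing c ℓ) (isDecidableDomain : IsDecidableDomain R) where

  open CommutativeRing R hiding (zero)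
  open IsDecidableDomain isDecidableDomain
  open Polynomials R
  open import Algebra.Properties.AbelianGroup +-abelianGroup using (inverseˡ-unique)
  open import Algebra.Properties.CommutativeMonoid.Sum *-commutativeMonoid
    using () renaming (sum to product; sum-remove to product-remove)
  open import Algebra.Properties.Ring ring using (x[y-z]≈xy-xz; -‿distribˡ-*)
  open import Algebra.Properties.Semiring.Exp semiring using (_^_)
  open import Algebra.Properties.Semiring.Sum semiring
    using (sum; sum-cong-≋; sum-cong-≗; ∑-distrib-+; ∑-comm; *-distribˡ-sum; *-distribʳ-sum)
  open import Algebra.Solver.CommutativeMonoid *-commutativeMonoid using (solve; _⊜_) renaming (_⊕_ to _⊗_)
  open import Relation.Binary.Reasoning.Setoid setoid

  *-≉0 : ∀ {x y} → x ≉ 0# → y ≉ 0# → x * y ≉ 0#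
  *-≉0 x≉0 y≉0 xy≈0 = [ x≉0 , y≉0 ]′ (zero-product xy≈0)

  *-cancelˡ-≈0 : ∀ {x y} → x ≉ 0# → x * y ≈ 0# → y ≈ 0#
  *-cancelˡ-≈0 x≉0 xy≈0 = [ ⊥-elim ∘ x≉0 , (λ y≈0 → y≈0) ]′ (zero-product xy≈0)

  product≉0 : ∀ {m} (f : Fin m → Carrier) → (∀ i → f i ≉ 0#) → product f ≉ 0#
  product≉0 {zero}  f f≉0 = 1≉0
  product≉0 {suc m} f f≉0 = *-≉0 (f≉0 zero) (product≉0 (f ∘ suc) (f≉0 ∘ suc))

  cofactor : ∀ {m} → (Fin m → Carrier) → Fin m → Carrier
  cofactor {suc m} f i = product (removeAt f i)

  product-cofactor : ∀ {m} (f : Fin m → Carrier) i → product f ≈ f i * cofactor f i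
  product-cofactor {suc m} f i = product-remove f

  Dependent : ∀ {I : Set} {K} → (Fin K → I → Carrier) → Set (c ⊔ ℓ)
  Dependent {K = K} v =
    ∃ λ (cc : Fin K → Carrier) → (∀ x → sum (λ j → cc j * v j x) ≈ 0#) × ∃ λ j → cc j ≉ 0#

  ¬independent⇒¬¬dependent : ∀ {I : Set} {K} {v : Fin K → I → Carrier} → ¬ Independent v → ¬ ¬ Dependent v
  ¬independent⇒¬¬dependent ¬independent ¬dependent = ¬independent λ cc relation j → case cc j ≟0 of λ where
    (yes ccj≈0) → ccj≈0
    (no  ccj≉0) → ⊥-elim (¬dependent (cc , relation , j , ccj≉0))

  first-zero⇒dependent : ∀ {I : Set} {K} (v : Fin (suc K) → I → Carrier) → (∀ x → v zero x ≈ 0#) →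
                         Dependent v
  first-zero⇒dependent {K = K} v v₀≈0 = e₀ , relation , zero , 1≉0
    where
    e₀ : Fin (suc K) → Carrier
    e₀ zero    = 1#
    e₀ (suc j) = 0#
    relation : ∀ x → sum (λ j → e₀ j * v j x) ≈ 0#
    relation x = trans (+-cong (trans (*-identityˡ _) (v₀≈0 x)) (sum-zero (λ j → zeroˡ (v (suc j) x))))
                       (+-identityʳ 0#)

  -- Gaussian elimination of coordinate s₀ from the vectors v (suc j), with v zero as pivot.
  module Pivot {R K} (v : Fin (suc K) → Fin (suc R) → Carrier) (s₀ : Fin (suc R)) where

    reduced : Fin K → Fin (suc R) → Carrier
    reduced j s = v zero s₀ * v (suc j) s - v zero s * v (suc j) s₀

    lift : (Fin K → Carrier) → Fin (suc K) → Carrier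
    lift c′ zero    = - sum (λ j → c′ j * v (suc j) s₀)
    lift c′ (suc j) = v zero s₀ * c′ j

    lift-relation : ∀ c′ s → sum (λ j → lift c′ j * v j s) ≈ sum (λ j → c′ j * reduced j s)
    lift-relation c′ s = begin
      - S₀ * v zero s + sum (λ j → (a * c′ j) * v (suc j) s)
        ≈⟨ +-congˡ (trans (sum-cong-≋ {K} (λ j → *-assoc a (c′ j) _))
                          (sym (*-distribˡ-sum a (λ j → c′ j * v (suc j) s)))) ⟩
      - S₀ * v zero s + a * T
        ≈⟨ trans (+-comm _ _)
                 (+-congˡ (trans (sym (-‿distribˡ-* S₀ (v zero s))) (-‿cong (*-comm S₀ (v zero s))))) ⟩
      a * T - v zero s * S₀
        ≈⟨ +-cong (*-distribˡ-sum a (λ j → c′ j * v (suc j) s))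
                  (trans (-‿cong (*-distribˡ-sum (v zero s) (λ j → c′ j * v (suc j) s₀)))
                         (sym (sum-neg (λ j → v zero s * (c′ j * v (suc j) s₀))))) ⟩
      sum (λ j → a * (c′ j * v (suc j) s)) + sum (λ j → - (v zero s * (c′ j * v (suc j) s₀)))
        ≈⟨ sym (∑-distrib-+ (λ j → a * (c′ j * v (suc j) s)) (λ j → - (v zero s * (c′ j * v (suc j) s₀)))) ⟩
      sum (λ j → a * (c′ j * v (suc j) s) - v zero s * (c′ j * v (suc j) s₀))
        ≈⟨ sum-cong-≋ {K} (λ j →
             sym (trans (x[y-z]≈xy-xz (c′ j) _ _) (+-cong (swap _ _ _) (-‿cong (swap _ _ _))))) ⟩
      sum (λ j → c′ j * reduced j s) ∎
      where
      a  = v zero s₀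
      S₀ = sum (λ j → c′ j * v (suc j) s₀)
      T  = sum (λ j → c′ j * v (suc j) s)
      swap : ∀ x y z → x * (y * z) ≈ y * (x * z)
      swap = solve 3 (λ x y z → (x ⊗ (y ⊗ z)) ⊜ (y ⊗ (x ⊗ z))) refl

    reduced-pivot : ∀ j → reduced j s₀ ≈ 0#
    reduced-pivot j = -‿inverseʳ (v zero s₀ * v (suc j) s₀)

    pivot-dependent : v zero s₀ ≉ 0# → Dependent (λ j → reduced j ∘ punchIn s₀) → Dependent v
    pivot-dependent a≉0 (c′ , c′-relation , j , c′j≉0) = lift c′ , relation , suc j , *-≉0 a≉0 c′j≉0
      where
      relation : ∀ s → sum (λ j → lift c′ j * v j s) ≈ 0#
      relation s with s Fin.≟ s₀
      ... | yes ≡.refl =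
          trans (lift-relation c′ s₀) (sum-zero (λ j → trans (*-congˡ (reduced-pivot j)) (zeroʳ _)))
      ... | no  s≢s₀   = trans (lift-relation c′ s)
          (≡.subst (λ t → sum (λ j → c′ j * reduced j t) ≈ 0#) (Finₚ.punchIn-punchOut (s≢s₀ ∘ ≡.sym))
                   (c′-relation (punchOut (s≢s₀ ∘ ≡.sym))))

  more-vectors-than-coordinates⇒dependent : ∀ {R K} → R < K → (v : Fin K → Fin R → Carrier) → Dependent v
  more-vectors-than-coordinates⇒dependent {zero}  {suc K} _         v = first-zero⇒dependent v (λ ())
  more-vectors-than-coordinates⇒dependent {suc R} {suc K} (s≤s R<K) v with all? (λ s → v zero s ≟0)
  ... | yes v₀≈0 = first-zero⇒dependent v (λ s → v₀≈0 s)
  ... | no  v₀≉0 with ¬∀⟶∃¬ (suc R) _ (λ s → v zero s ≟0) v₀≉0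
  ...   | s₀ , pivot≉0 = Pivot.pivot-dependent v s₀ pivot≉0 (more-vectors-than-coordinates⇒dependent R<K _)

  record IsLinear {I : Set} {R} (f : (Fin R → Carrier) → I → Carrier) : Set (c ⊔ ℓ) where
    field
      cong   : ∀ {G H} → (∀ s → G s ≈ H s) → ∀ x → f G x ≈ f H x
      linear : ∀ {K} (cc : Fin K → Carrier) (A : Fin K → Fin R → Carrier) x →
               f (λ s → sum (λ j → cc j * A j s)) x ≈ sum (λ j → cc j * f (A j) x)

  -- Membership up to a nonzero scalar, as the ring need not be a field.
  ScaledInImage : ∀ {I : Set} {R} → ((Fin R → Carrier) → I → Carrier) → (I → Carrier) → Set (c ⊔ ℓ)
  ScaledInImage f v = ∃₂ λ α A → α ≉ 0# × ∀ x → α * v x ≈ f A x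

  ScaledInSpan : ∀ {I : Set} {r} → (I → Carrier) → (Fin r → I → Carrier) → Set (c ⊔ ℓ)
  ScaledInSpan v w = ScaledInImage (λ λ′ x → sum (λ s → λ′ s * w s x)) v

  ScaledInSpan-cong : ∀ {I : Set} {r} {v v′ : I → Carrier} {w w′ : Fin r → I → Carrier} →
                      (∀ x → v x ≈ v′ x) → (∀ s x → w s x ≈ w′ s x) → ScaledInSpan v w → ScaledInSpan v′ w′
  ScaledInSpan-cong {r = r} v≈v′ w≈w′ (α , λ′ , α≉0 , scaled) = α , λ′ , α≉0 , λ x →
    trans (*-congˡ (sym (v≈v′ x))) (trans (scaled x) (sum-cong-≋ {r} (λ s → *-congˡ (w≈w′ s x))))

  independent-in-image⇒≤ : ∀ {I : Set} {K R} (f : (Fin R → Carrier) → I → Carrier) → IsLinear f →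
                           (v : Fin K → I → Carrier) → Independent v → (∀ j → ScaledInImage f (v j)) → K ≤ R
  independent-in-image⇒≤ {K = K} {R} f f-linear v v-independent v∈image with K ℕₚ.≤? R
  ... | yes K≤R = K≤R
  ... | no  K≰R = absurd (more-vectors-than-coordinates⇒dependent (ℕₚ.≰⇒> K≰R) A)
    where
    open IsLinear f-linear
    α = λ j → proj₁ (v∈image j)
    A = λ j → proj₁ (proj₂ (v∈image j))
    absurd : Dependent A → K ≤ R
    absurd (cc , A-relation , j₀ , ccj₀≉0) =
      ⊥-elim (*-≉0 ccj₀≉0 (proj₁ (proj₂ (proj₂ (v∈image j₀)))) (v-independent (λ j → cc j * α j) relation j₀))
      where
      relation : ∀ x → sum (λ j → (cc j * α j) * v j x) ≈ 0#
      relation x = begin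
        sum (λ j → (cc j * α j) * v j x)
          ≈⟨ sum-cong-≋ {K} (λ j → trans (*-assoc _ _ _) (*-congˡ (proj₂ (proj₂ (proj₂ (v∈image j))) x))) ⟩
        sum (λ j → cc j * f (A j) x)          ≈⟨ sym (linear cc A x) ⟩
        f (λ s → sum (λ j → cc j * A j s)) x  ≈⟨ cong A-relation x ⟩
        f (λ _ → 0#) x                        ≈⟨ linear {K = 0} (λ ()) (λ ()) x ⟩
        0#                                    ∎

  extension-dependent⇒ScaledInSpan : ∀ {I : Set} {r} {v : I → Carrier} {w : Fin r → I → Carrier} →
                                     Independent w → Dependent (v ∷ w) → ScaledInSpan v w
  extension-dependent⇒ScaledInSpan {I} {r} {v} {w} w-independent (cc , relation , j , ccj≉0) =
    cc zero , (λ s → - cc (suc s)) , cc₀≉0 , scaled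
    where
    rest : I → Carrier
    rest x = sum (λ s → cc (suc s) * w s x)
    cc₀≉0 : cc zero ≉ 0#
    cc₀≉0 cc₀≈0 = ccj≉0 (cc≈0 j)
      where
      rest≈0 : ∀ x → rest x ≈ 0#
      rest≈0 x = trans (sym (trans (+-congʳ (trans (*-congʳ cc₀≈0) (zeroˡ (v x)))) (+-identityˡ (rest x))))
                       (relation x)
      cc≈0 : ∀ j → cc j ≈ 0#
      cc≈0 zero    = cc₀≈0
      cc≈0 (suc s) = w-independent (cc ∘ suc) rest≈0 s
    scaled : ∀ x → cc zero * v x ≈ sum (λ s → - cc (suc s) * w s x)
    scaled x = begin
      cc zero * v x                       ≈⟨ inverseˡ-unique _ _ (relation x) ⟩
      - rest x                            ≈⟨ sym (sum-neg (λ s → cc (suc s) * w s x)) ⟩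
      sum (λ s → - (cc (suc s) * w s x))  ≈⟨ sum-cong-≋ {r} (λ s → -‿distribˡ-* (cc (suc s)) (w s x)) ⟩
      sum (λ s → - cc (suc s) * w s x)    ∎

  Distinct : ∀ {m} → (Fin m → Carrier) → Set ℓ
  Distinct y = ∀ {i j} → i ≢ j → y i - y j ≉ 0#

  roots⇒zero : ∀ {m} (y : Fin m → Carrier) → Distinct y → ∀ L (f : Poly) → DegreeBelow L f → L ≤ m →
               (∀ i → eval L f (y i) ≈ 0#) → ∀ j → f j ≈ 0#
  roots⇒zero y y-distinct zero    f f<0   _         _      j = f<0 j z≤n
  roots⇒zero y y-distinct (suc L) f f<1+L (s≤s L≤m) f[y]≈0 j = begin
    f j                                              ≈⟨ division (suc L) a f f<1+L j ⟩
    constant (eval (suc L) f a) j + mulLinear a g j  ≈⟨ +-cong (constant≈0 j) (mulLinear≈0 j) ⟩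
    0# + 0#                                          ≈⟨ +-identityʳ 0# ⟩
    0#                                               ∎
    where
    a = y zero
    g = quotient (suc L) a f
    g[y]≈0 : ∀ i → eval L g (y (suc i)) ≈ 0#
    g[y]≈0 i = *-cancelˡ-≈0 (y-distinct {suc i} {zero} (λ ())) (begin
      (y (suc i) - a) * eval L g (y (suc i))                     ≈⟨ sym (+-identityˡ _) ⟩
      0# + (y (suc i) - a) * eval L g (y (suc i))                ≈⟨ +-congʳ (sym (f[y]≈0 zero)) ⟩
      eval (suc L) f a + (y (suc i) - a) * eval L g (y (suc i))
        ≈⟨ sym (eval-division L a f (y (suc i)) f<1+L) ⟩
      eval (suc L) f (y (suc i))                                 ≈⟨ f[y]≈0 (suc i) ⟩
      0#                                                         ∎)
    g≈0 : ∀ j → g j ≈ 0#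
    g≈0 = roots⇒zero (y ∘ suc) (λ i≢j → y-distinct (i≢j ∘ Finₚ.suc-injective)) L g
                     (DegreeBelow-quotient L a f) L≤m g[y]≈0
    constant≈0 : ∀ j → constant (eval (suc L) f a) j ≈ 0#
    constant≈0 zero    = f[y]≈0 zero
    constant≈0 (suc j) = refl
    mulLinear≈0 : ∀ j → mulLinear a g j ≈ 0#
    mulLinear≈0 zero    = trans (+-identityˡ _) (trans (*-congˡ (g≈0 0)) (zeroʳ _))
    mulLinear≈0 (suc j) = trans (+-cong (g≈0 j) (trans (*-congˡ (g≈0 (suc j))) (zeroʳ _))) (+-identityʳ 0#)

  shifted-powers-independent :
    ∀ {m ρ l} N {B : Set} (y : Fin m → Carrier) → Distinct y → (k : Fin m) → N ℕ.+ l ≤ m →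
    (Q : Fin ρ → B → Poly) → (∀ q b → DegreeBelow (suc l) (Q q b)) →
    Independent (λ q b → eval (suc l) (Q q b) (y k)) →
    (cc : Fin N → Fin ρ → Carrier) →
    (∀ i b → sum (λ a → sum (λ q → cc a q * ((y i - y k) ^ toℕ a * eval (suc l) (Q q b) (y i)))) ≈ 0#) →
    ∀ a q → cc a q ≈ 0#
  shifted-powers-independent {ρ = ρ} {l} N y y-distinct k N+l≤m Q Q<1+l Q[yₖ]-independent cc vanishes a q =
    begin
      cc a q       ≈⟨ reflexive (≡.sym (fromVector-toℕ (λ a → cc a q) a)) ⟩
      u q (toℕ a)  ≈⟨ combination-zero Q[yₖ]-independent N u W≈0 q (toℕ a) (Finₚ.toℕ<n a) ⟩
      0#           ∎
    where
    open Combination Q Q<1+l (y k)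
    u : Fin ρ → Poly
    u q = fromVector (λ a → cc a q)
    W[y]≈0 : ∀ b i → eval (N ℕ.+ l) (combination N u b) (y i) ≈ 0#
    W[y]≈0 b i = begin
      eval (N ℕ.+ l) (combination N u b) (y i)
        ≈⟨ eval-combination N u b (y i) ⟩
      sum (λ q → Qᵢ q * eval N (u q) (y i - y k))
        ≈⟨ sum-cong-≋ {ρ} (λ q → *-congˡ (eval-fromVector N (λ a → cc a q) (y i - y k))) ⟩
      sum (λ q → Qᵢ q * sum (λ a → cc a q * (y i - y k) ^ toℕ a))
        ≈⟨ sum-cong-≋ {ρ} (λ q → trans (*-distribˡ-sum (Qᵢ q) (λ a → cc a q * (y i - y k) ^ toℕ a))
             (sum-cong-≋ {N} (λ a →
               solve 3 (λ x c p → (x ⊗ (c ⊗ p)) ⊜ (c ⊗ (p ⊗ x))) refl (Qᵢ q) (cc a q) _))) ⟩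
      sum (λ q → sum (λ a → cc a q * ((y i - y k) ^ toℕ a * Qᵢ q)))
        ≈⟨ ∑-comm (λ q a → cc a q * ((y i - y k) ^ toℕ a * Qᵢ q)) ⟩
      sum (λ a → sum (λ q → cc a q * ((y i - y k) ^ toℕ a * Qᵢ q)))
        ≈⟨ vanishes i b ⟩
      0# ∎
      where Qᵢ = λ q → eval (suc l) (Q q b) (y i)
    W≈0 : ∀ b j → combination N u b j ≈ 0#
    W≈0 b = roots⇒zero y y-distinct (N ℕ.+ l) (combination N u b) (DegreeBelow-combination N u b) N+l≤m
                       (W[y]≈0 b)

  module RankInequality {m n l} (y : Fin m → Carrier) (y-distinct : Distinct y) (l≤m : l ≤ m)
    (P : Fin n → Fin n → Poly) (P<1+l : ∀ a b → DegreeBelow (suc l) (P a b))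
    (r : Fin m → ℕ) (σ : (i : Fin m) → Fin (r i) → Fin n) (k : Fin m) where

    M : Fin m → Fin n → Fin n → Carrier
    M i a b = eval (suc l) (P a b) (y i)

    shiftedColumn : Fin (m ∸ l) → Fin (r k) → Fin m × Fin n → Carrier
    shiftedColumn e q (i , b) = (y i - y k) ^ toℕ e * M i b (σ k q)

    blockwise : (Fin (sumFin r) → Carrier) → Fin m × Fin n → Carrier
    blockwise G (i , b) = sum (λ s → G (embed r i s) * M i b (σ i s))

    blockwise-linear : IsLinear blockwise
    blockwise-linear = record
      { cong   = λ { G≈H (i , b) → sum-cong-≋ {r i} (λ s → *-congʳ (G≈H (embed r i s))) }
      ; linear = linear
      }
      where
      linear : ∀ {K} (cc : Fin K → Carrier) A x →
               blockwise (λ s → sum (λ j → cc j * A j s)) x ≈ sum (λ j → cc j * blockwise (A j) x)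
      linear {K} cc A (i , b) = begin
        sum (λ s → sum (λ j → cc j * A j (embed r i s)) * Mᵢ s)
          ≈⟨ sum-cong-≋ {r i} (λ s → trans (*-distribʳ-sum (Mᵢ s) (λ j → cc j * A j (embed r i s)))
                                           (sum-cong-≋ {K} (λ j → *-assoc _ _ _))) ⟩
        sum (λ s → sum (λ j → cc j * (A j (embed r i s) * Mᵢ s)))
          ≈⟨ ∑-comm (λ s j → cc j * (A j (embed r i s) * Mᵢ s)) ⟩
        sum (λ j → sum (λ s → cc j * (A j (embed r i s) * Mᵢ s)))
          ≈⟨ sum-cong-≋ {K} (λ j → sym (*-distribˡ-sum (cc j) (λ s → A j (embed r i s) * Mᵢ s))) ⟩
        sum (λ j → cc j * blockwise (A j) (i , b)) ∎
        where Mᵢ = λ s → M i b (σ i s)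

    split : Fin ((m ∸ l) ℕ.* r k) → Fin (m ∸ l) × Fin (r k)
    split = remQuot (r k)

    merge : Fin (m ∸ l) → Fin (r k) → Fin ((m ∸ l) ℕ.* r k)
    merge = combine

    shiftedColumns : Fin ((m ∸ l) ℕ.* r k) → Fin m × Fin n → Carrier
    shiftedColumns J = uncurry shiftedColumn (split J)

    shiftedColumns-merge : ∀ e q → shiftedColumns (merge e q) ≡ shiftedColumn e q
    shiftedColumns-merge e q = ≡.cong (uncurry shiftedColumn) (Finₚ.remQuot-combine e q)

    shiftedColumns-independent : Independent (λ q b → M k b (σ k q)) → Independent shiftedColumns
    shiftedColumns-independent σₖ-independent cc relation J = begin
      cc J                          ≡⟨ ≡.cong cc (≡.sym (Finₚ.combine-remQuot {m ∸ l} (r k) J)) ⟩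
      cc (uncurry merge (split J))  ≈⟨ uncurry coefficients≈0 (split J) ⟩
      0#                            ∎
      where
      vanishes : ∀ i b → sum (λ e → sum (λ q → cc (merge e q) * shiftedColumn e q (i , b))) ≈ 0#
      vanishes i b = begin
        sum (λ e → sum (λ q → cc (merge e q) * shiftedColumn e q (i , b)))
          ≡⟨ ≡.sym (sum-cong-≗ λ e → sum-cong-≗ λ q →
               ≡.cong (λ v → cc (merge e q) * v (i , b)) (shiftedColumns-merge e q)) ⟩
        sum (λ e → sum (λ q → cc (merge e q) * shiftedColumns (merge e q) (i , b)))
          ≈⟨ sym (sum-combine (m ∸ l) (r k) (λ J → cc J * shiftedColumns J (i , b))) ⟩
        sum (λ J → cc J * shiftedColumns J (i , b))
          ≈⟨ relation (i , b) ⟩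
        0# ∎
      coefficients≈0 : ∀ e q → cc (merge e q) ≈ 0#
      coefficients≈0 = shifted-powers-independent (m ∸ l) y y-distinct k (ℕₚ.≤-reflexive (ℕₚ.m∸n+n≡m l≤m))
        (λ q b → P b (σ k q)) (λ q b → P<1+l b (σ k q)) σₖ-independent (λ e q → cc (merge e q)) vanishes

    module _ (σₖ∈span : ∀ i q → ScaledInSpan (λ b → M i b (σ k q)) (λ s b → M i b (σ i s))) where

      -- Block i only needs the scalar α i, so their product serves all blocks at once.
      shiftedColumn∈image : ∀ e q → ScaledInImage blockwise (shiftedColumn e q)
      shiftedColumn∈image e q = product α , block r entry , product≉0 α α≉0 , scaled
        where
        α : Fin m → Carrier
        α i = proj₁ (σₖ∈span i q)
        α≉0 : ∀ i → α i ≉ 0#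
        α≉0 i = proj₁ (proj₂ (proj₂ (σₖ∈span i q)))
        λ′ : (i : Fin m) → Fin (r i) → Carrier
        λ′ i = proj₁ (proj₂ (σₖ∈span i q))
        entry : (i : Fin m) → Fin (r i) → Carrier
        entry i s = cofactor α i * ((y i - y k) ^ toℕ e * λ′ i s)
        scaled : ∀ x → product α * shiftedColumn e q x ≈ blockwise (block r entry) x
        scaled (i , b) = begin
          product α * (d * M i b (σ k q))
            ≈⟨ *-congʳ (product-cofactor α i) ⟩
          (α i * β) * (d * M i b (σ k q))
            ≈⟨ solve 4 (λ a b d x → ((a ⊗ b) ⊗ (d ⊗ x)) ⊜ (b ⊗ (d ⊗ (a ⊗ x)))) refl (α i) β d _ ⟩
          β * (d * (α i * M i b (σ k q)))
            ≈⟨ *-congˡ (*-congˡ (proj₂ (proj₂ (proj₂ (σₖ∈span i q))) b)) ⟩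
          β * (d * sum (λ s → λ′ i s * Mᵢ s))
            ≈⟨ trans (*-congˡ (*-distribˡ-sum d (λ s → λ′ i s * Mᵢ s)))
                     (*-distribˡ-sum β (λ s → d * (λ′ i s * Mᵢ s))) ⟩
          sum (λ s → β * (d * (λ′ i s * Mᵢ s)))
            ≈⟨ sum-cong-≋ {r i} (λ s → solve 4 (λ b d l x → (b ⊗ (d ⊗ (l ⊗ x))) ⊜ ((b ⊗ (d ⊗ l)) ⊗ x))
                                                refl β d (λ′ i s) (Mᵢ s)) ⟩
          sum (λ s → entry i s * Mᵢ s)
            ≡⟨ sum-cong-≗ (λ s → ≡.cong (_* Mᵢ s) (≡.sym (block-embed r entry i s))) ⟩
          blockwise (block r entry) (i , b) ∎
          where
          β  = cofactor α i
          d  = (y i - y k) ^ toℕ e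
          Mᵢ = λ s → M i b (σ i s)

    rank-inequality : Independent (λ q b → M k b (σ k q)) →
                      (∀ i q → ScaledInSpan (λ b → M i b (σ k q)) (λ s b → M i b (σ i s))) →
                      (m ∸ l) ℕ.* r k ≤ sumFin r
    rank-inequality σₖ-independent σₖ∈span =
      independent-in-image⇒≤ blockwise blockwise-linear
        shiftedColumns (shiftedColumns-independent σₖ-independent)
        (λ J → uncurry (shiftedColumn∈image σₖ∈span) (split J))

open import Data.Nat using (_+_; _*_)

module Residues (p : ℕ) .{{_ : NonZero p}} where

  infix 4 _≈ₚ_
  _≈ₚ_ : ℕ → ℕ → Set
  x ≈ₚ y = x % p ≡ y % p

  -ₚ_ : ℕ → ℕ
  -ₚ x = (p ∸ 1) * x

  ≡⇒≈ₚ : ∀ {x y} → x ≡ y → x ≈ₚ y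
  ≡⇒≈ₚ = ≡.cong (_% p)

  ≈ₚ-+ : ∀ {x x′ y y′} → x ≈ₚ x′ → y ≈ₚ y′ → x + y ≈ₚ x′ + y′
  ≈ₚ-+ {x} {x′} {y} {y′} x≈x′ y≈y′ = ≡.trans (%-distribˡ-+ x y p)
    (≡.trans (≡.cong₂ (λ a b → (a + b) % p) x≈x′ y≈y′) (≡.sym (%-distribˡ-+ x′ y′ p)))

  ≈ₚ-* : ∀ {x x′ y y′} → x ≈ₚ x′ → y ≈ₚ y′ → x * y ≈ₚ x′ * y′
  ≈ₚ-* {x} {x′} {y} {y′} x≈x′ y≈y′ = ≡.trans (%-distribˡ-* x y p)
    (≡.trans (≡.cong₂ (λ a b → (a * b) % p) x≈x′ y≈y′) (≡.sym (%-distribˡ-* x′ y′ p)))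

  0%p≡0 : 0 % p ≡ 0
  0%p≡0 = m<n⇒m%n≡m (ℕ.>-nonZero⁻¹ p)

  -ₚ-inverseʳ : ∀ x → x + -ₚ x ≈ₚ 0
  -ₚ-inverseʳ x = ≡.trans (≡⇒≈ₚ x+[p∸1]x≡xp) (≡.trans (m*n%n≡0 x p) (≡.sym 0%p≡0))
    where
    x+[p∸1]x≡xp : x + (p ∸ 1) * x ≡ x * p
    x+[p∸1]x≡xp = ≡.trans (≡.cong (_+ (p ∸ 1) * x) (≡.sym (ℕₚ.*-identityˡ x)))
                 (≡.trans (≡.sym (ℕₚ.*-distribʳ-+ x 1 (p ∸ 1)))
                 (≡.trans (≡.cong (_* x) (ℕₚ.m+[n∸m]≡n (ℕ.>-nonZero⁻¹ p))) (ℕₚ.*-comm p x)))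

  isCommutativeRing : IsCommutativeRing _≈ₚ_ _+_ _*_ -ₚ_ 0 1
  isCommutativeRing = record
    { isRing = record
      { +-isAbelianGroup = record
        { isGroup = record
          { isMonoid = record
            { isSemigroup = record
              { isMagma = record
                { isEquivalence = record { refl = ≡.refl ; sym = ≡.sym ; trans = ≡.trans }
                ; ∙-cong        = ≈ₚ-+
                }
              ; assoc = λ x y z → ≡⇒≈ₚ (ℕₚ.+-assoc x y z)
              }
            ; identity = (λ x → ≡⇒≈ₚ (ℕₚ.+-identityˡ x)) , (λ x → ≡⇒≈ₚ (ℕₚ.+-identityʳ x))
            }
          ; inverse = (λ x → ≡.trans (≡⇒≈ₚ (ℕₚ.+-comm (-ₚ x) x)) (-ₚ-inverseʳ x)) , -ₚ-inverseʳ
          ; ⁻¹-cong = ≈ₚ-* {p ∸ 1} ≡.refl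
          }
        ; comm = λ x y → ≡⇒≈ₚ (ℕₚ.+-comm x y)
        }
      ; *-cong     = ≈ₚ-*
      ; *-assoc    = λ x y z → ≡⇒≈ₚ (ℕₚ.*-assoc x y z)
      ; *-identity = (λ x → ≡⇒≈ₚ (ℕₚ.*-identityˡ x)) , (λ x → ≡⇒≈ₚ (ℕₚ.*-identityʳ x))
      ; distrib    = (λ x y z → ≡⇒≈ₚ (ℕₚ.*-distribˡ-+ x y z)) , (λ x y z → ≡⇒≈ₚ (ℕₚ.*-distribʳ-+ x y z))
      }
    ; *-comm = λ x y → ≡⇒≈ₚ (ℕₚ.*-comm x y)
    }

  ℤ/pℤ : CommutativeRing 0ℓ 0ℓ
  ℤ/pℤ = record { isCommutativeRing = isCommutativeRing }

  ≈ₚ0⇒∣ : ∀ {x} → x ≈ₚ 0 → p ∣ x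
  ≈ₚ0⇒∣ {x} x≈0 = m%n≡0⇒n∣m x p (≡.trans x≈0 0%p≡0)

  ∣⇒≈ₚ0 : ∀ {x} → p ∣ x → x ≈ₚ 0
  ∣⇒≈ₚ0 {x} p∣x = ≡.trans (n∣m⇒m%n≡0 x p p∣x) (≡.sym 0%p≡0)

  _≟ₚ0 : ∀ x → Dec (x ≈ₚ 0)
  x ≟ₚ0 = x % p ℕ.≟ 0 % p

  module _ (p-prime : Prime p) where

    zero-product : ∀ {x y} → x * y ≈ₚ 0 → x ≈ₚ 0 ⊎ y ≈ₚ 0
    zero-product {x} {y} xy≈0 = Sum.map ∣⇒≈ₚ0 ∣⇒≈ₚ0 (euclidsLemma x y p-prime (≈ₚ0⇒∣ xy≈0))

    1≉ₚ0 : ¬ (1 ≈ₚ 0)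
    1≉ₚ0 1≈0 = ℕₚ.<⇒≱ (nonTrivial⇒n>1 p {{prime⇒nonTrivial p-prime}}) (∣⇒≤ (≈ₚ0⇒∣ 1≈0))

    isDecidableDomain : IsDecidableDomain ℤ/pℤ
    isDecidableDomain = record { _≟0 = _≟ₚ0 ; zero-product = zero-product ; 1≉0 = 1≉ₚ0 }

¬¬-∀ : ∀ {a k} {P : Fin k → Set a} → (∀ i → ¬ ¬ P i) → ¬ ¬ (∀ i → P i)
¬¬-∀ {k = zero}  ¬¬P ¬∀P = ¬∀P (λ ())
¬¬-∀ {k = suc k} ¬¬P ¬∀P = ¬¬P zero λ P₀ → ¬¬-∀ (¬¬P ∘ suc) λ P₊ → ¬∀P λ { zero → P₀ ; (suc i) → P₊ i }

module Reduction (p : ℕ) .{{_ : NonZero p}} (p-prime : Prime p) where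

  open Residues p
  open CommutativeRing ℤ/pℤ using (semiring; setoid; +-abelianGroup; sym)
  open Polynomials ℤ/pℤ
  open IntegralDomain ℤ/pℤ (isDecidableDomain p-prime)
  open import Algebra.Properties.AbelianGroup +-abelianGroup using (x∙y⁻¹≈ε⇒x≈y)
  open import Algebra.Properties.Semiring.Exp semiring using (_^_)
  open import Algebra.Properties.Semiring.Sum semiring using (sum; sum-cong-≋; sum-cong-≗)
  open import Relation.Binary.Reasoning.Setoid setoid

  sum≡sumFin : ∀ {K} (f : Fin K → ℕ) → sum f ≡ sumFin f
  sum≡sumFin {zero}  f = ≡.refl
  sum≡sumFin {suc K} f = ≡.cong (f zero +_) (sum≡sumFin (f ∘ suc))

  LinIndep⇒Independent : ∀ {n K} {v : Fin K → Fin n → ℕ} → LinIndep p v → Independent v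
  LinIndep⇒Independent {v = v} v-independent cc relation j = ∣⇒≈ₚ0 (v-independent cc
    (λ a → ≈ₚ0⇒∣ (≡.subst (_≈ₚ 0) (sum≡sumFin (λ j → cc j * v j a)) (relation a))) j)

  Independent⇒LinIndep : ∀ {n K} {v : Fin K → Fin n → ℕ} → Independent v → LinIndep p v
  Independent⇒LinIndep {v = v} v-independent c relation j = ≈ₚ0⇒∣ (v-independent c
    (λ a → ≡.subst (_≈ₚ 0) (≡.sym (sum≡sumFin (λ j → c j * v j a))) (∣⇒≈ₚ0 (relation a))) j)

  module _ {n ρ} (M : Fin n → Fin n → ℕ) (rank : HasRank p M ρ) where

    basis : Fin ρ → Fin n
    basis = proj₁ (proj₁ rank)

    basis-independent : Independent (λ s a → M a (basis s))
    basis-independent = LinIndep⇒Independent (proj₂ (proj₁ rank))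

    column-¬¬∈span : ∀ b → ¬ ¬ ScaledInSpan (λ a → M a b) (λ s a → M a (basis s))
    column-¬¬∈span b = ¬¬-map (extension-dependent⇒ScaledInSpan basis-independent)
      (¬independent⇒¬¬dependent {v = extended} (proj₂ rank (b ∷ basis) ∘ Independent⇒LinIndep {v = extended}))
      where
      extended : Fin (suc ρ) → Fin n → ℕ
      extended = (λ a → M a b) ∷ (λ s a → M a (basis s))

  mod-p^1 : ∀ z → modP^ p 1 z ≈ₚ z
  mod-p^1 z = ≡.trans (≡⇒≈ₚ (%-congʳ {{ℕₚ.m^n≢0 p 1}} (ℕₚ.^-identityʳ p))) (m%n%n≡m%n z p)

  sumSeq-level₁ : ∀ {K} (f : Fin K → Seq p) → sumSeq p f 1 ≈ₚ sum (λ j → f j 1)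
  sumSeq-level₁ {zero}  f = mod-p^1 0
  sumSeq-level₁ {suc K} f = ≡.trans (mod-p^1 _) (≈ₚ-+ {f zero 1} ≡.refl (sumSeq-level₁ (f ∘ suc)))

  ^ₛ-level₁ : ∀ (a : Seq p) t → _^ₛ_ p a t 1 ≈ₚ a 1 ^ t
  ^ₛ-level₁ a zero    = mod-p^1 1
  ^ₛ-level₁ a (suc t) = ≡.trans (mod-p^1 _) (≈ₚ-* {a 1} ≡.refl (^ₛ-level₁ a t))

  reduced : ∀ {n l} → LthIntegral p n l → Fin n → Fin n → Poly
  reduced {l = l} P a b = fromVector (λ j → p ℕ.^ (toℕ j ∸ l) * seq (coef P j a b) 1)

  positive-power≈0 : ∀ e c → 0 < e → p ℕ.^ e * c ≈ₚ 0
  positive-power≈0 (suc u) c _ = ∣⇒≈ₚ0 (∣-trans (m∣m*n (p ℕ.^ u)) (m∣m*n c))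

  DegreeBelow-reduced : ∀ {n l} (P : LthIntegral p n l) a b → DegreeBelow (suc l) (reduced P a b)
  DegreeBelow-reduced {l = l} P a b = DegreeBelow-fromVector (suc (l + r P)) _ (suc l)
    (λ j l<j → positive-power≈0 (toℕ j ∸ l) (seq (coef P j a b) 1) (ℕₚ.m<n⇒0<n∸m l<j))

  redEval≈eval : ∀ {n l} (P : LthIntegral p n l) x a b →
                 redEval p P x a b ≈ₚ eval (suc l) (reduced P a b) (seq x 1)
  redEval≈eval {l = l} P x a b = begin
    redEval p P x a b
      ≈⟨ sumSeq-level₁ term ⟩
    sum (λ j → term j 1)
      ≈⟨ sum-cong-≋ {suc (l + r P)} (λ j → ≡.trans (mod-p^1 _) (≈ₚ-*
           (≡.trans (mod-p^1 _) (≈ₚ-* (^ₛ-level₁ (seq x) (toℕ j)) (mod-p^1 (pʲ j))))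
           (≡.refl {x = cⱼ j % p}))) ⟩
    sum (λ j → (y ^ toℕ j * pʲ j) * cⱼ j)
      ≡⟨ sum-cong-≗ (λ j →
           ≡.trans (ℕₚ.*-assoc (y ^ toℕ j) (pʲ j) (cⱼ j)) (ℕₚ.*-comm (y ^ toℕ j) (pʲ j * cⱼ j))) ⟩
    sum (λ j → (pʲ j * cⱼ j) * y ^ toℕ j)
      ≈⟨ sym (eval-fromVector (suc (l + r P)) (λ j → pʲ j * cⱼ j) y) ⟩
    eval (suc (l + r P)) (reduced P a b) y
      ≈⟨ eval-extend (suc l) (suc (l + r P)) (reduced P a b) y (DegreeBelow-reduced P a b)
                     (s≤s (ℕₚ.m≤m+n l (r P))) ⟩
    eval (suc l) (reduced P a b) y ∎
    where
    y = seq x 1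
    pʲ : Fin (suc (l + r P)) → ℕ
    pʲ j = p ℕ.^ (toℕ j ∸ l)
    cⱼ : Fin (suc (l + r P)) → ℕ
    cⱼ j = seq (coef P j a b) 1
    term : Fin (suc (l + r P)) → Seq p
    term j = _⊗ₛ_ p (_⊗ₛ_ p (_^ₛ_ p (seq x) (toℕ j)) (const p (pʲ j))) (seq (coef P j a b))

  distinct-residues : ∀ {m} (x : Fin m → ℤp p) → DistinctRed p x → Distinct (λ i → seq (x i) 1)
  distinct-residues x x-distinct {i} {j} i≢j yᵢ-yⱼ≈0 = i≢j (x-distinct i j
    (≡.trans (≡.sym (m<n⇒m%n≡m (residue<p i)))
    (≡.trans (x∙y⁻¹≈ε⇒x≈y (seq (x i) 1) (seq (x j) 1) yᵢ-yⱼ≈0) (m<n⇒m%n≡m (residue<p j)))))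
    where
    residue<p : ∀ i → seq (x i) 1 < p
    residue<p i = ≡.subst (seq (x i) 1 <_) (ℕₚ.^-identityʳ p) (bound (x i) 1)

  -- HasRank states the maximality of the rank negatively, so the spanning columns are only
  -- available under a double negation.
  rank-bound : ∀ {m} (x : Fin m → ℤp p) → DistinctRed p x → ∀ {l} → l ≤ m →
               ∀ {n} (H : Fin m → FGModule) (P : LthIntegral p n l) →
               (∀ i → CokDim p (redEval p P (x i)) (s (H i))) →
               ∀ k → ¬ ¬ ((m ∸ l) * d₀ n (H k) ≤ sumFin (λ i → d₀ n (H i)))
  rank-bound {m} x x-distinct {l} l≤m {n} H P cok k =
    ¬¬-map (λ spans → rank-inequality basisₖ-independent (λ i q →
              ScaledInSpan-cong (M≈eval i (σ k q)) (λ s → M≈eval i (σ i s)) (spans i q)))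
           (¬¬-∀ λ i → ¬¬-∀ λ q → column-¬¬∈span (M i) (rank i) (σ k q))
    where
    y : Fin m → ℕ
    y i = seq (x i) 1
    ranks : Fin m → ℕ
    ranks i = d₀ n (H i)
    M : Fin m → Fin n → Fin n → ℕ
    M i = redEval p P (x i)
    rank : ∀ i → HasRank p (M i) (ranks i)
    rank i = proj₂ (cok i)
    σ : ∀ i → Fin (ranks i) → Fin n
    σ i = basis (M i) (rank i)
    M≈eval : ∀ i b a → M i a b ≈ₚ eval (suc l) (reduced P a b) (y i)
    M≈eval i b a = redEval≈eval P (x i) a b
    basisₖ-independent : Independent (λ q b → eval (suc l) (reduced P b (σ k q)) (y k))
    basisₖ-independent = Independent-cong (λ q b → M≈eval k (σ k q) b) (basis-independent (M k) (rank k))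
    open RankInequality y (distinct-residues x x-distinct) l≤m (reduced P) (DegreeBelow-reduced P) ranks σ k
      using (rank-inequality)

argmax : ∀ {m} (f : Fin (suc m) → ℕ) → ∃ λ k → ∀ i → f i ≤ f k
argmax {zero}  f = zero , λ { zero → ℕₚ.≤-refl }
argmax {suc m} f with argmax (f ∘ suc)
... | k , f≤fk with ℕₚ.≤-total (f zero) (f (suc k))
...   | inj₁ f₀≤fk = suc k , λ { zero → f₀≤fk ; (suc i) → f≤fk i }
...   | inj₂ fk≤f₀ = zero  , λ { zero → ℕₚ.≤-refl ; (suc i) → ℕₚ.≤-trans (f≤fk i) fk≤f₀ }

lemma3p6 : (p : ℕ) .{{_ : NonZero p}} → Prime p →
    (m : ℕ) (x : Fin m → ℤp p) → DistinctRed p x →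
    (l : ℕ) → l ≤ m →
    (n : ℕ) (H : Fin m → FGModule) →
    InC p x l n H →
    Σ ℕ (λ α₀ → (∀ i → d₀ n (H i) ≤ α₀)
               × (m ∸ l) * α₀ ≤ sumFin (λ i → d₀ n (H i)))
lemma3p6 p p-prime zero    x x-distinct l l≤m n H _ = 0 , (λ ()) , ℕₚ.≤-reflexive (ℕₚ.*-zeroʳ (0 ∸ l))
lemma3p6 p p-prime (suc m) x x-distinct l l≤m n H (_ , P , cok) with argmax (λ i → d₀ n (H i))
... | k , d₀≤d₀ₖ = d₀ n (H k) , d₀≤d₀ₖ ,
  decidable-stable (_ ℕ.≤? _) (Reduction.rank-bound p p-prime x x-distinct l≤m H P cok k)
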